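{- Let $\lambda$ be a partition and $c_1,c_2$ cells in the Young diagram of $\lambda$ such that $|h(c_1)|\ge|\lambda|/2$ and $|h(c_2)|>|\lambda|/2$. Then $c_1$ and $c_2$ lie either in the same row or in the same column.
   Context: Partitions are identified with their Young diagrams; $|\lambda|$ is the number of cells. The hook $h(c)$ of a cell $c$ consists of $c$ together with all cells to its right in its row and all cells below it in its column; $|h(c)|$ is its number of cells. -}

module Defs where

open import Data.Nat using (ℕ; zero; suc; _+_; _*_; _∸_; _≤_; _<_; _≥_; _>_; _<ᵇ_)
open import Data.List using (List; []; _∷_; length; drop)
open import Data.Nat.ListAction using (sum)
open import Data.Bool using (true; false)
open import Data.List.Relation.Unary.All using (All)
open import Data.List.Relation.Unary.Linked using (Linked)
open import Data.Product using (_×_; Σ; _,_)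

-- A partition is the list of its (positive) row lengths, weakly decreasing
-- from top to bottom (English convention: row 0 is the top row).
record Partition : Set where
  constructor mkPartition
  field
    rows     : List ℕ
    positive : All (λ r → r > 0) rows
    decr     : Linked _≥_ rows
open Partition public

size : Partition → ℕ
size λp = sum (rows λp)

rowLen : List ℕ → ℕ → ℕ
rowLen []       _       = 0
rowLen (r ∷ rs) zero    = r
rowLen (r ∷ rs) (suc i) = rowLen rs i

-- cell (i , j) = row i, column j (0-indexed) lies in the Young diagram
_∈D_ : ℕ × ℕ → Partition → Set
(i , j) ∈D λp = j < rowLen (rows λp) i

-- number of rows of ℓ of length > j (i.e. cells in column j among rows ℓ)
countLonger : List ℕ → ℕ → ℕ
countLonger []       j = 0
countLonger (r ∷ rs) j with j <ᵇ r
... | true  = suc (countLonger rs j)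
... | false = countLonger rs j

hookSize : Partition → ℕ × ℕ → ℕ
hookSize λp (i , j) =
  suc ((rowLen (rows λp) i ∸ suc j) + countLonger (drop (suc i) (rows λp)) j)

-- Two cells in different rows and different columns have hooks that together
-- cover at most |λ| cells: when one cell lies south-east of the other the hooks
-- are disjoint, and when it lies south-west they share at most the cell where
-- the upper cell's column meets the lower cell's row, which is compensated by
-- the cell where the lower cell's column meets the upper cell's row, lying in
-- neither hook.
module Submission where

open import Defs
open import Data.Nat using (ℕ; _*_; _≥_; _>_)
open import Data.Product using (_×_; _,_)
open import Data.Sum using (_⊎_)
open import Relation.Binary.PropositionalEquality using (_≡_)

open import Data.Bool using (Bool; true; false)
open import Data.Empty using (⊥-elim)
open import Data.List using (List; []; _∷_; drop)
open import Data.Nat using (zero; suc; _+_; _∸_; _≤_; _<_; _<ᵇ_; z≤n; s≤s)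
open import Data.Nat.ListAction using (sum)
open import Data.Nat.Properties
open import Algebra.Properties.CommutativeSemigroup +-commutativeSemigroup using (interchange)
open import Data.Sum using (inj₁; inj₂)
open import Data.Unit using (tt)
open import Relation.Binary using (tri<; tri≈; tri>)
open import Relation.Binary.PropositionalEquality using (_≢_; refl; sym; cong; cong₂; subst; ≢-sym)
open import Relation.Nullary using (yes; no)

indicator : Bool → ℕ
indicator true  = 1
indicator false = 0

countLonger-∷ : ∀ r rs j → countLonger (r ∷ rs) j ≡ indicator (j <ᵇ r) + countLonger rs j
countLonger-∷ r rs j with j <ᵇ r
... | true  = refl
... | false = refl

indicator-<ᵇ-≤ : ∀ j r → indicator (j <ᵇ r) ≤ r
indicator-<ᵇ-≤ j r with j <ᵇ r | <ᵇ⇒< j r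
... | true  | j<r = ≤-trans (s≤s z≤n) (j<r tt)
... | false | _   = z≤n

indicator-<ᵇ-pair-≤ : ∀ {j j'} r → j ≢ j' → indicator (j <ᵇ r) + indicator (j' <ᵇ r) ≤ r
indicator-<ᵇ-pair-≤ {j} {j'} r j≢j' with j <ᵇ r | <ᵇ⇒< j r | j' <ᵇ r | <ᵇ⇒< j' r
... | false | _   | false | _    = z≤n
... | false | _   | true  | j'<r = ≤-trans (s≤s z≤n) (j'<r tt)
... | true  | j<r | false | _    = ≤-trans (s≤s z≤n) (j<r tt)
... | true  | j<r | true  | j'<r with <-cmp j j'
...   | tri< j<j' _ _ = ≤-trans (s≤s (≤-trans (s≤s z≤n) j<j')) (j'<r tt)
...   | tri≈ _ j≡j' _ = ⊥-elim (j≢j' j≡j')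
...   | tri> _ _ j'<j = ≤-trans (s≤s (≤-trans (s≤s z≤n) j'<j)) (j<r tt)

-- The lower cell's row holds its arm and possibly one leg cell of the upper
-- cell; the slack j is paid for by the j cells of the upper cell's row to the
-- left of column j, which lie in neither hook.
indicator-<ᵇ+arm-≤ : ∀ {j j'} r → j ≢ j' → indicator (j <ᵇ r) + (r ∸ j') ≤ r + j
indicator-<ᵇ+arm-≤ {zero}  {zero}   r       0≢0 = ⊥-elim (0≢0 refl)
indicator-<ᵇ+arm-≤ {zero}  {suc j'} zero    _   = z≤n
indicator-<ᵇ+arm-≤ {zero}  {suc j'} (suc r) _   =
  subst (suc (r ∸ j') ≤_) (sym (+-identityʳ (suc r))) (s≤s (m∸n≤m r j'))
indicator-<ᵇ+arm-≤ {suc j} {j'}     r       _   = begin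
  indicator (suc j <ᵇ r) + (r ∸ j') ≤⟨ +-mono-≤ (indicator-≤-1 (suc j <ᵇ r)) (m∸n≤m r j') ⟩
  1 + r                             ≡⟨ +-comm 1 r ⟩
  r + 1                             ≤⟨ +-monoʳ-≤ r (s≤s z≤n) ⟩
  r + suc j                         ∎
  where
  open ≤-Reasoning
  indicator-≤-1 : ∀ b → indicator b ≤ 1
  indicator-≤-1 true  = ≤-refl
  indicator-≤-1 false = z≤n

countLonger-pair≤sum : ∀ rs {j j'} → j ≢ j' → countLonger rs j + countLonger rs j' ≤ sum rs
countLonger-pair≤sum []       _    = z≤n
countLonger-pair≤sum (r ∷ rs) {j} {j'} j≢j' = begin
  countLonger (r ∷ rs) j + countLonger (r ∷ rs) j'
    ≡⟨ cong₂ _+_ (countLonger-∷ r rs j) (countLonger-∷ r rs j') ⟩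
  (indicator (j <ᵇ r) + countLonger rs j) + (indicator (j' <ᵇ r) + countLonger rs j')
    ≡⟨ interchange (indicator (j <ᵇ r)) (countLonger rs j) (indicator (j' <ᵇ r)) (countLonger rs j') ⟩
  (indicator (j <ᵇ r) + indicator (j' <ᵇ r)) + (countLonger rs j + countLonger rs j')
    ≤⟨ +-mono-≤ (indicator-<ᵇ-pair-≤ r j≢j') (countLonger-pair≤sum rs j≢j') ⟩
  r + sum rs ∎
  where open ≤-Reasoning

countLonger≤sum : ∀ rs j → countLonger rs j ≤ sum rs
countLonger≤sum []       j = z≤n
countLonger≤sum (r ∷ rs) j = begin
  countLonger (r ∷ rs) j              ≡⟨ countLonger-∷ r rs j ⟩
  indicator (j <ᵇ r) + countLonger rs j ≤⟨ +-mono-≤ (indicator-<ᵇ-≤ j r) (countLonger≤sum rs j) ⟩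
  r + sum rs                          ∎
  where open ≤-Reasoning

hook : List ℕ → ℕ → ℕ → ℕ
hook rs i j = suc ((rowLen rs i ∸ suc j) + countLonger (drop (suc i) rs) j)

hook-≡ : ∀ rs i {j} → j < rowLen rs i →
         hook rs i j ≡ (rowLen rs i ∸ j) + countLonger (drop (suc i) rs) j
hook-≡ rs i {j} j<r = cong (_+ countLonger (drop (suc i) rs) j) (sym (+-∸-assoc 1 j<r))

countLonger+hook≤sum : ∀ rs k {j j'} → j ≢ j' → j' < rowLen rs k →
                       countLonger rs j + hook rs k j' ≤ sum rs + j
countLonger+hook≤sum (s ∷ u) zero {j} {j'} j≢j' j'<s = begin
  countLonger (s ∷ u) j + hook (s ∷ u) zero j'
    ≡⟨ cong₂ _+_ (countLonger-∷ s u j) (hook-≡ (s ∷ u) zero j'<s) ⟩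
  (indicator (j <ᵇ s) + countLonger u j) + ((s ∸ j') + countLonger u j')
    ≡⟨ interchange (indicator (j <ᵇ s)) (countLonger u j) (s ∸ j') (countLonger u j') ⟩
  (indicator (j <ᵇ s) + (s ∸ j')) + (countLonger u j + countLonger u j')
    ≤⟨ +-mono-≤ (indicator-<ᵇ+arm-≤ s j≢j') (countLonger-pair≤sum u j≢j') ⟩
  (s + j) + sum u
    ≡⟨ +-assoc s j (sum u) ⟩
  s + (j + sum u)
    ≡⟨ cong (s +_) (+-comm j (sum u)) ⟩
  s + (sum u + j)
    ≡⟨ +-assoc s (sum u) j ⟨
  (s + sum u) + j ∎
  where open ≤-Reasoning
countLonger+hook≤sum (s ∷ u) (suc k) {j} {j'} j≢j' j'<rₖ = begin
  countLonger (s ∷ u) j + hook u k j'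
    ≡⟨ cong (_+ hook u k j') (countLonger-∷ s u j) ⟩
  (indicator (j <ᵇ s) + countLonger u j) + hook u k j'
    ≡⟨ +-assoc (indicator (j <ᵇ s)) (countLonger u j) (hook u k j') ⟩
  indicator (j <ᵇ s) + (countLonger u j + hook u k j')
    ≤⟨ +-mono-≤ (indicator-<ᵇ-≤ j s) (countLonger+hook≤sum u k j≢j' j'<rₖ) ⟩
  s + (sum u + j)
    ≡⟨ +-assoc s (sum u) j ⟨
  (s + sum u) + j ∎
  where open ≤-Reasoning

hook+hook≤sum : ∀ rs {i i' j j'} → i < i' → j ≢ j' → j < rowLen rs i → j' < rowLen rs i' →
                hook rs i j + hook rs i' j' ≤ sum rs
hook+hook≤sum (r ∷ t) {zero} {suc k} {j} {j'} _ j≢j' j<r j'<r' = begin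
  hook (r ∷ t) zero j + hook t k j'
    ≡⟨ cong (_+ hook t k j') (hook-≡ (r ∷ t) zero j<r) ⟩
  ((r ∸ j) + countLonger t j) + hook t k j'
    ≡⟨ +-assoc (r ∸ j) (countLonger t j) (hook t k j') ⟩
  (r ∸ j) + (countLonger t j + hook t k j')
    ≤⟨ +-monoʳ-≤ (r ∸ j) (countLonger+hook≤sum t k j≢j' j'<r') ⟩
  (r ∸ j) + (sum t + j)
    ≡⟨ cong ((r ∸ j) +_) (+-comm (sum t) j) ⟩
  (r ∸ j) + (j + sum t)
    ≡⟨ +-assoc (r ∸ j) j (sum t) ⟨
  ((r ∸ j) + j) + sum t
    ≡⟨ cong (_+ sum t) (m∸n+n≡m (<⇒≤ j<r)) ⟩
  r + sum t ∎
  where open ≤-Reasoning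
hook+hook≤sum (r ∷ t) {suc i} {suc i'} (s≤s i<i') j≢j' j<r j'<r' =
  ≤-trans (hook+hook≤sum t i<i' j≢j' j<r j'<r') (m≤n+m (sum t) r)

hook+hook≤size : ∀ λp {i i' j j'} → i ≢ i' → j ≢ j' → (i , j) ∈D λp → (i' , j') ∈D λp →
                 hookSize λp (i , j) + hookSize λp (i' , j') ≤ size λp
hook+hook≤size λp {i} {i'} {j} {j'} i≢i' j≢j' c c' with <-cmp i i'
... | tri< i<i' _ _ = hook+hook≤sum (rows λp) i<i' j≢j' c c'
... | tri≈ _ i≡i' _ = ⊥-elim (i≢i' i≡i')
... | tri> _ _ i'<i = subst (_≤ size λp) (+-comm (hookSize λp (i' , j')) (hookSize λp (i , j)))
                        (hook+hook≤sum (rows λp) i'<i (≢-sym j≢j') c' c)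

m+n≤o≤2m⇒2n≤o : ∀ m n {o} → m + n ≤ o → o ≤ 2 * m → 2 * n ≤ o
m+n≤o≤2m⇒2n≤o m n {o} m+n≤o o≤2m = begin
  2 * n       ≡⟨ cong (n +_) (+-identityʳ n) ⟩
  n + n       ≤⟨ +-monoˡ-≤ n n≤m ⟩
  m + n       ≤⟨ m+n≤o ⟩
  o           ∎
  where
  open ≤-Reasoning
  n≤m : n ≤ m
  n≤m = +-cancelˡ-≤ m n m (≤-trans m+n≤o (subst (o ≤_) (cong (m +_) (+-identityʳ m)) o≤2m))

lemma2p4 : (λp : Partition) (i₁ j₁ i₂ j₂ : ℕ) →
    (i₁ , j₁) ∈D λp → (i₂ , j₂) ∈D λp →
    2 * hookSize λp (i₁ , j₁) ≥ size λp →
    2 * hookSize λp (i₂ , j₂) > size λp →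
    (i₁ ≡ i₂) ⊎ (j₁ ≡ j₂)
lemma2p4 λp i₁ j₁ i₂ j₂ c₁ c₂ large₁ large₂ with i₁ ≟ i₂ | j₁ ≟ j₂
... | yes i₁≡i₂ | _         = inj₁ i₁≡i₂
... | no _      | yes j₁≡j₂ = inj₂ j₁≡j₂
... | no i₁≢i₂  | no j₁≢j₂  = ⊥-elim (<⇒≱ large₂
  (m+n≤o≤2m⇒2n≤o (hookSize λp (i₁ , j₁)) (hookSize λp (i₂ , j₂))
    (hook+hook≤size λp i₁≢i₂ j₁≢j₂ c₁ c₂) large₁))
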